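{- Let $C^{\mathrm{del}}$ (resp. $C^{\mathrm{con}}$) be the positive-degree truncation of $(\mathcal M_\bullet,\partial_{\mathrm{del}})$ (resp. $(\mathcal M_\bullet,\partial_{\mathrm{con}})$): $C_n=\mathcal M_n$ for $n\ge1$, $C_n=0$ for $n\le0$, with differential $\partial_{\mathrm{del}}$ (resp. $\partial_{\mathrm{con}}$) from $C_n$ to $C_{n-1}$ for $n\ge2$ and zero on $C_1$. Then $H_1(C^{\mathrm{del}})\cong H_1(C^{\mathrm{con}})\cong\mathbb Q$ and $H_n(C^{\mathrm{del}})=H_n(C^{\mathrm{con}})=0$ for all $n\ge2$. (These truncations are the matroid deletion and contraction complexes of Alekseyevskaya–Borovik–Gelfand–White tensored with $\mathbb Q$.)
   Context: An orientation of a matroid $\mathsf M$ is a generator $\eta$ of $\bigwedge^{|E|}\mathbb{Z}\langle E\rangle$, $E=E(\mathsf M)$; $\varnothing$ has orientation $1$. $\mathcal M$ is the $\mathbb{Q}$-vector space spanned by symbols $[\mathsf M,\eta]$ modulo $[\mathsf M,-\eta]=-[\mathsf M,\eta]$ and $[\mathsf M,\eta]=[\mathsf M',\psi_*\eta]$ for every matroid isomorphism $\psi:\mathsf M\to\mathsf M'$ ($\psi_*$ the induced map on top exterior powers), graded by ground-set size ($\mathcal M_n$ spanned by classes with $|E(\mathsf M)|=n$). With $\iota_x$ interior product ($\iota_x(x\wedge\alpha)=\alpha$): $\partial_{\mathrm{del}}[\mathsf M,\eta]=\sum_{x\text{ not a coloop}}[\mathsf M\setminus x,\iota_x\eta]$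 and $\partial_{\mathrm{con}}[\mathsf M,\eta]=\sum_{x\text{ not a loop}}[\mathsf M/x,\iota_x\eta]$; both are differentials of degree $-1$. -}

module Defs where

open import Data.Nat using (ℕ; zero; suc; _<_)
open import Data.Bool using (Bool; true; false; _∧_; _∨_; not; if_then_else_)
open import Data.Fin using (Fin; toℕ) renaming (_<?_ to _<ᶠ?_)
open import Data.Fin.Subset using (Subset; ⊥; ⁅_⁆; _∈_; _∉_; _⊆_; _∪_; ∣_∣)
open import Data.Fin.Subset.Properties using (_∈?_)
open import Data.Fin.Permutation using (Permutation′; _⟨$⟩ʳ_; _⟨$⟩ˡ_)
open import Data.Vec using (Vec; []; _∷_; lookup; tabulate; insertAt)
open import Data.List using (List; []; _∷_; map; _++_; concatMap; filter; length; allFin)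
open import Data.Product using (_×_; _,_; ∃)
open import Data.Rational using (ℚ; 0ℚ; 1ℚ; _+_; _*_; _-_; -_)
open import Relation.Nullary using (does)
open import Relation.Binary.PropositionalEquality using (_≡_)

RawSys : ℕ → Set
RawSys n = Subset n → Bool

record Matroid (n : ℕ) : Set where
  field
    indep : RawSys n
    I1 : indep ⊥ ≡ true
    I2 : ∀ {S T} → S ⊆ T → indep T ≡ true → indep S ≡ true
    I3 : ∀ {S T} → indep S ≡ true → indep T ≡ true → ∣ S ∣ < ∣ T ∣ →
         ∃ λ x → x ∈ T × x ∉ S × indep (⁅ x ⁆ ∪ S) ≡ true
open Matroid public

allSubsets : (n : ℕ) → List (Subset n)
allSubsets zero = [] ∷ []
allSubsets (suc n) = map (true ∷_) (allSubsets n) ++ map (false ∷_) (allSubsets n)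

allB : ∀ {A : Set} → (A → Bool) → List A → Bool
allB p [] = true
allB p (x ∷ xs) = p x ∧ allB p xs

_==ᵇ_ : Bool → Bool → Bool
true ==ᵇ b = b
false ==ᵇ b = not b

eqSys : ∀ {n} → RawSys n → RawSys n → Bool
eqSys {n} I J = allB (λ S → I S ==ᵇ J S) (allSubsets n)

memb : ∀ {n} → Fin n → Subset n → Bool
memb x S = does (x ∈? S)

isBasis : ∀ {n} → Matroid n → Subset n → Bool
isBasis {n} M B = indep M B ∧ allB (λ y → memb y B ∨ not (indep M (⁅ y ⁆ ∪ B))) (allFin n)

isColoop : ∀ {n} → Matroid n → Fin n → Bool
isColoop {n} M x = allB (λ B → not (isBasis M B) ∨ memb x B) (allSubsets n)

isLoop : ∀ {n} → Matroid n → Fin n → Bool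
isLoop M x = not (indep M ⁅ x ⁆)

-- deletion / contraction of element i, ground set Fin (suc k) ∖ {i}
-- relabelled order-preservingly as Fin k
delSys : ∀ {k} → RawSys (suc k) → Fin (suc k) → RawSys k
delSys I i S = I (insertAt S i false)

conSys : ∀ {k} → RawSys (suc k) → Fin (suc k) → RawSys k
conSys I i S = I (insertAt S i true)

signℕ : ℕ → ℚ
signℕ zero = 1ℚ
signℕ (suc m) = - signℕ m

ind : Bool → ℚ
ind b = if b then 1ℚ else 0ℚ

sumℚ : List ℚ → ℚ
sumℚ [] = 0ℚ
sumℚ (q ∷ qs) = q + sumℚ qs

inversions : ∀ {n} → Permutation′ n → ℕ
inversions {n} σ =
  length (filter (λ p → Data.Product.proj₁ p <ᶠ? Data.Product.proj₂ p)
    (filter (λ p → (σ ⟨$⟩ʳ Data.Product.proj₂ p) <ᶠ? (σ ⟨$⟩ʳ Data.Product.proj₁ p))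
      (concatMap (λ i → map (i ,_) (allFin n)) (allFin n))))

sgn : ∀ {n} → Permutation′ n → ℚ
sgn σ = signℕ (inversions σ)

image : ∀ {n} → Permutation′ n → Subset n → Subset n
image σ S = tabulate (λ j → lookup S (σ ⟨$⟩ˡ j))

-- Chains: formal ℚ-linear combinations of matroids on Fin n (standard orientation
-- e₀ ∧ … ∧ e_{n-1}).  Their coefficient functions live on raw set systems.
Chain : ℕ → Set
Chain n = List (ℚ × Matroid n)

coeff : ∀ {n} → Chain n → RawSys n → ℚ
coeff [] N = 0ℚ
coeff ((q , M) ∷ x) N = q * ind (eqSys (indep M) N) + coeff x N

zeroF : ∀ {n} → RawSys n → ℚ
zeroF N = 0ℚ

-- Generators of the relations defining 𝓜ₙ:  [M, std] − sgn σ · [M', std]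
-- for σ an isomorphism M → M'  (ψ_*(std) = sgn σ · std).
record Gen (n : ℕ) : Set where
  field
    src tgt : Matroid n
    perm : Permutation′ n
    iso : ∀ S → indep tgt (image perm S) ≡ indep src S

genCoeff : ∀ {n} → Gen n → RawSys n → ℚ
genCoeff g N = ind (eqSys (indep (Gen.src g)) N) - sgn (Gen.perm g) * ind (eqSys (indep (Gen.tgt g)) N)

-- f and g (coefficient functions) define the same element of 𝓜ₙ
Rel : ∀ {n} → (RawSys n → ℚ) → (RawSys n → ℚ) → Set
Rel {n} f g = ∃ λ (gs : List (ℚ × Gen n)) →
  ∀ N → f N - g N ≡ sumℚ (map (λ cg → Data.Product.proj₁ cg * genCoeff (Data.Product.proj₂ cg) N) gs)

data Kind : Set where
  deletion contraction : Kind

-- ∂_del / ∂_con on the standard orientation: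
-- ι_i (e₀ ∧ … ∧ e_k) = (-1)^i e₀ ∧ … ê_i … ∧ e_k
boundary : ∀ {k} → Kind → Chain (suc k) → RawSys k → ℚ
boundary {k} deletion [] N = 0ℚ
boundary {k} deletion ((q , M) ∷ x) N =
  sumℚ (map (λ i → q * signℕ (toℕ i) * ind (not (isColoop M i) ∧ eqSys (delSys (indep M) i) N)) (allFin (suc k)))
  + boundary deletion x N
boundary {k} contraction [] N = 0ℚ
boundary {k} contraction ((q , M) ∷ x) N =
  sumℚ (map (λ i → q * signℕ (toℕ i) * ind (not (isLoop M i) ∧ eqSys (conSys (indep M) i) N)) (allFin (suc k)))
  + boundary contraction x N

-- Adjoining a new element 0 as a loop (for deletion) or as a coloop (for contraction) is a cone
-- operator h on chains with ∂h + h∂ = id.  It respects the isomorphism relations, since a relabelling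
-- extends to the cones by fixing 0, with the same sign.  So a cycle x of degree ≥ 2 satisfies
-- x = ∂(hx) + h(∂x) ≈ ∂(hx).  In degree 1 every matroid is the one-point loop or the one-point
-- coloop.  For deletion the coloop is the boundary of its cone, so every class is a multiple of the
-- loop (dually for contraction).  The loop itself is not a boundary: its coefficient vanishes on the
-- boundary of every two-point matroid, whose two points yield the same minor with opposite signs,
-- and on every relation, since the only relabelling of one point is the identity.

{-# OPTIONS --safe #-}
module Submission where

open import Defs
open import Data.Nat using (ℕ; suc; _≤_)
open import Data.Product using (_×_; _,_; ∃)
open import Data.Rational using (ℚ; _*_; _-_)
open import Relation.Nullary using (¬_)

open import Data.Bool using (Bool; true; false; _∧_; _∨_; not; if_then_else_)
open import Data.Bool.Properties using (∧-assoc; ∧-zeroʳ; ∨-conicalˡ; ∨-conicalʳ; not-injective)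
open import Data.Fin using (Fin; zero; suc; toℕ) renaming (_<?_ to _<ᶠ?_)
open import Data.Fin.Permutation using (Permutation′; _⟨$⟩ʳ_; _⟨$⟩ˡ_; lift₀)
open import Data.Fin.Subset using (Subset; ⊥; ⁅_⁆; _∈_; _∉_; _⊆_; _∪_; ∣_∣)
open import Data.Fin.Subset.Properties using (_∈?_; ∈⊤; ∣p∣≤n; ∣p∣≡n⇒p≡⊤; ∪-identityˡ)
open import Data.List using (List; []; _∷_; _++_; map; concatMap; filter; length; allFin)
open import Data.List.Properties using (map-++; map-∘; map-cong; map-tabulate)
open import Data.Nat using (zero)
import Data.Nat as ℕ
import Data.Nat.Properties as ℕ
open import Data.Nat.ListAction using (sum)
open import Data.Nat.ListAction.Properties using (sum-++)
open import Data.Product using (proj₁; proj₂; map₂)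
open import Data.Rational using (0ℚ; 1ℚ; _+_; -_)
import Data.Rational.Properties as ℚ
open import Data.Rational.Solver using (module +-*-Solver)
open import Data.Sum using (_⊎_; inj₁; inj₂; swap)
open import Data.Vec using ([]; _∷_; here; there)
open import Function using (_∘_; id)
open import Level using (Level)
open import Relation.Binary.PropositionalEquality
open import Relation.Nullary using (yes; no; does; contradiction)
open import Relation.Unary using (Pred; Decidable)

open +-*-Solver using (solve; _:+_; _:*_; :-_; _:-_; _:=_; con)

private variable
  ℓ : Level
  A B : Set
  k n : ℕ

allB-++ : (p : A → Bool) (xs ys : List A) → allB p (xs ++ ys) ≡ allB p xs ∧ allB p ys
allB-++ p [] ys = refl
allB-++ p (x ∷ xs) ys = trans (cong (p x ∧_) (allB-++ p xs ys)) (sym (∧-assoc (p x) _ _))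

allB-map : (p : B → Bool) (f : A → B) (xs : List A) → allB p (map f xs) ≡ allB (p ∘ f) xs
allB-map p f [] = refl
allB-map p f (x ∷ xs) = cong (p (f x) ∧_) (allB-map p f xs)

allB-cong : {p q : A → Bool} → p ≗ q → (xs : List A) → allB p xs ≡ allB q xs
allB-cong p≗q [] = refl
allB-cong p≗q (x ∷ xs) = cong₂ _∧_ (p≗q x) (allB-cong p≗q xs)

allB-true : {p : A → Bool} → (∀ x → p x ≡ true) → (xs : List A) → allB p xs ≡ true
allB-true p≡true [] = refl
allB-true p≡true (x ∷ xs) = cong₂ _∧_ (p≡true x) (allB-true p≡true xs)

allB-∧ : (p q : A → Bool) (xs : List A) → allB (λ x → p x ∧ q x) xs ≡ allB p xs ∧ allB q xs
allB-∧ p q [] = refl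
allB-∧ p q (x ∷ xs) with p x | q x
... | true  | true  = allB-∧ p q xs
... | true  | false = sym (∧-zeroʳ _)
... | false | _     = refl

allB-counterexample : (p : A → Bool) (xs : List A) → allB p xs ≡ true ⊎ ∃ λ x → p x ≡ false
allB-counterexample p [] = inj₁ refl
allB-counterexample p (x ∷ xs) with p x in px | allB-counterexample p xs
... | false | _      = inj₂ (x , px)
... | true  | result = result

allB-allFin-suc : (p : Fin (suc n) → Bool) → allB p (allFin (suc n)) ≡ p zero ∧ allB (p ∘ suc) (allFin n)
allB-allFin-suc {n} p = cong (p zero ∧_) (trans (cong (allB p) (sym (map-tabulate id suc))) (allB-map p suc (allFin n)))

allB-allSubsets-suc : (p : Subset (suc n) → Bool) →
  allB p (allSubsets (suc n)) ≡ allB (p ∘ (true ∷_)) (allSubsets n) ∧ allB (p ∘ (false ∷_)) (allSubsets n)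
allB-allSubsets-suc {n} p = trans (allB-++ p (map (true ∷_) (allSubsets n)) (map (false ∷_) (allSubsets n)))
  (cong₂ _∧_ (allB-map p (true ∷_) (allSubsets n)) (allB-map p (false ∷_) (allSubsets n)))

allB-allSubsets-false : (p : Subset n → Bool) (S : Subset n) → p S ≡ false → allB p (allSubsets n) ≡ false
allB-allSubsets-false p [] pS≡false = cong (_∧ true) pS≡false
allB-allSubsets-false p (true ∷ S) pS≡false = trans (allB-allSubsets-suc p)
  (cong (_∧ allB (p ∘ (false ∷_)) (allSubsets _)) (allB-allSubsets-false (p ∘ (true ∷_)) S pS≡false))
allB-allSubsets-false p (false ∷ S) pS≡false = trans (allB-allSubsets-suc p)
  (trans (cong (allB (p ∘ (true ∷_)) (allSubsets _) ∧_) (allB-allSubsets-false (p ∘ (false ∷_)) S pS≡false))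
         (∧-zeroʳ _))

==ᵇ-refl : ∀ b → (b ==ᵇ b) ≡ true
==ᵇ-refl true = refl
==ᵇ-refl false = refl

==ᵇ-∧-==ᵇ : ∀ r a b → (r ==ᵇ a) ∧ (r ==ᵇ b) ≡ (a ==ᵇ b) ∧ (r ==ᵇ a)
==ᵇ-∧-==ᵇ true  true  true  = refl
==ᵇ-∧-==ᵇ true  true  false = refl
==ᵇ-∧-==ᵇ true  false true  = refl
==ᵇ-∧-==ᵇ true  false false = refl
==ᵇ-∧-==ᵇ false true  true  = refl
==ᵇ-∧-==ᵇ false true  false = refl
==ᵇ-∧-==ᵇ false false true  = refl
==ᵇ-∧-==ᵇ false false false = refl

∧-leftComm : ∀ a b c → a ∧ (b ∧ c) ≡ b ∧ (a ∧ c)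
∧-leftComm true  b c = refl
∧-leftComm false b c = sym (∧-zeroʳ b)

eqSys-refl : (R : RawSys n) → eqSys R R ≡ true
eqSys-refl {n} R = allB-true (==ᵇ-refl ∘ R) (allSubsets n)

eqSys-congˡ : {R R′ : RawSys n} → R ≗ R′ → ∀ N → eqSys R N ≡ eqSys R′ N
eqSys-congˡ {n} R≗R′ N = allB-cong (λ S → cong (_==ᵇ N S) (R≗R′ S)) (allSubsets n)

eqSys-suc : (R N : RawSys (suc n)) →
  eqSys R N ≡ eqSys (conSys R zero) (conSys N zero) ∧ eqSys (delSys R zero) (delSys N zero)
eqSys-suc R N = allB-allSubsets-suc (λ S → R S ==ᵇ N S)

ind-∧ : ∀ a b → ind (a ∧ b) ≡ ind a * ind b
ind-∧ true  b = sym (ℚ.*-identityˡ (ind b))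
ind-∧ false b = sym (ℚ.*-zeroˡ (ind b))

sumℚ-allFin-suc : (f : Fin (suc n) → ℚ) →
  sumℚ (map f (allFin (suc n))) ≡ f zero + sumℚ (map (f ∘ suc) (allFin n))
sumℚ-allFin-suc f = cong (λ xs → f zero + sumℚ xs) (trans (map-tabulate suc f) (sym (map-tabulate id (f ∘ suc))))

sumℚ-map-*ˡ : (c : ℚ) (f : A → ℚ) (xs : List A) → sumℚ (map (λ x → c * f x) xs) ≡ c * sumℚ (map f xs)
sumℚ-map-*ˡ c f [] = sym (ℚ.*-zeroʳ c)
sumℚ-map-*ˡ c f (x ∷ xs) = trans (cong (c * f x +_) (sumℚ-map-*ˡ c f xs)) (sym (ℚ.*-distribˡ-+ c (f x) _))

ind-eqSys-decompose : {R A : RawSys n} (B : RawSys n) → R ≗ A → eqSys A B ≡ false → ∀ N →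
  ind (eqSys R N) ≡ ind (eqSys R A) * ind (eqSys A N) + ind (eqSys R B) * ind (eqSys B N)
ind-eqSys-decompose {R = R} {A} B R≗A A≢B N = begin
  ind (eqSys R N)              ≡⟨ cong ind (eqSys-congˡ R≗A N) ⟩
  a                            ≡⟨ solve 2 (λ a b → a := con 1ℚ :* a :+ con 0ℚ :* b) refl a b ⟩
  ind true * a + ind false * b ≡⟨ cong₂ (λ u v → ind u * a + ind v * b)
                                        (trans (eqSys-congˡ R≗A A) (eqSys-refl A))
                                        (trans (eqSys-congˡ R≗A B) A≢B) ⟨
  ind (eqSys R A) * a + ind (eqSys R B) * b ∎
  where
  open ≡-Reasoning
  a = ind (eqSys A N)
  b = ind (eqSys B N)

-- Signs of permutations

length-filter-filter : ∀ {P Q : Pred A ℓ} (P? : Decidable P) (Q? : Decidable Q) xs →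
  length (filter P? (filter Q? xs)) ≡ sum (map (λ x → if does (Q? x) ∧ does (P? x) then 1 else 0) xs)
length-filter-filter P? Q? [] = refl
length-filter-filter P? Q? (x ∷ xs) with does (Q? x)
... | false = length-filter-filter P? Q? xs
... | true with does (P? x)
...   | false = length-filter-filter P? Q? xs
...   | true = cong suc (length-filter-filter P? Q? xs)

sum-concatMap : (f : B → ℕ) (g : A → List B) (xs : List A) →
  sum (map f (concatMap g xs)) ≡ sum (map (λ x → sum (map f (g x))) xs)
sum-concatMap f g [] = refl
sum-concatMap f g (x ∷ xs) = begin
  sum (map f (g x ++ concatMap g xs))                ≡⟨ cong sum (map-++ f (g x) _) ⟩
  sum (map f (g x) ++ map f (concatMap g xs))        ≡⟨ sum-++ (map f (g x)) _ ⟩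
  sum (map f (g x)) ℕ.+ sum (map f (concatMap g xs)) ≡⟨ cong (sum (map f (g x)) ℕ.+_) (sum-concatMap f g xs) ⟩
  sum (map f (g x)) ℕ.+ sum (map (λ x → sum (map f (g x))) xs) ∎
  where open ≡-Reasoning

sum-allFin-suc : (f : Fin (suc n) → ℕ) →
  sum (map f (allFin (suc n))) ≡ f zero ℕ.+ sum (map (f ∘ suc) (allFin n))
sum-allFin-suc f = cong (λ xs → f zero ℕ.+ sum xs) (trans (map-tabulate suc f) (sym (map-tabulate id (f ∘ suc))))

sum-zeros : (f : A → ℕ) → (∀ x → f x ≡ 0) → ∀ xs → sum (map f xs) ≡ 0
sum-zeros f f≡0 [] = refl
sum-zeros f f≡0 (x ∷ xs) = cong₂ ℕ._+_ (f≡0 x) (sum-zeros f f≡0 xs)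

inverted : (Fin n → Fin n) → Fin n × Fin n → ℕ
inverted f (i , j) = if does (f j <ᶠ? f i) ∧ does (i <ᶠ? j) then 1 else 0

invertedPairs : (Fin n → Fin n) → ℕ
invertedPairs {n} f = sum (map (λ i → sum (map (λ j → inverted f (i , j)) (allFin n))) (allFin n))

inversions≡invertedPairs : (σ : Permutation′ n) → inversions σ ≡ invertedPairs (σ ⟨$⟩ʳ_)
inversions≡invertedPairs {n} σ = begin
  inversions σ
    ≡⟨ length-filter-filter _ _ (concatMap row (allFin n)) ⟩
  sum (map (inverted (σ ⟨$⟩ʳ_)) (concatMap row (allFin n)))
    ≡⟨ sum-concatMap (inverted (σ ⟨$⟩ʳ_)) row (allFin n) ⟩
  sum (map (λ i → sum (map (inverted (σ ⟨$⟩ʳ_)) (row i))) (allFin n))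
    ≡⟨ cong sum (map-cong (λ i → cong sum (sym (map-∘ (allFin n)))) (allFin n)) ⟩
  invertedPairs (σ ⟨$⟩ʳ_) ∎
  where
  open ≡-Reasoning
  row : Fin n → List (Fin n × Fin n)
  row i = map (i ,_) (allFin n)

invertedPairs-lift₀ : (σ : Permutation′ n) → invertedPairs (lift₀ σ ⟨$⟩ʳ_) ≡ invertedPairs (σ ⟨$⟩ʳ_)
invertedPairs-lift₀ {n} σ = begin
  sum (map row′ (allFin (suc n)))                   ≡⟨ sum-allFin-suc row′ ⟩
  row′ zero ℕ.+ sum (map (row′ ∘ suc) (allFin n))
    ≡⟨ cong₂ ℕ._+_ row′-zero (cong sum (map-cong row′-suc (allFin n))) ⟩
  invertedPairs (σ ⟨$⟩ʳ_)                          ∎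
  where
  open ≡-Reasoning
  σ′ = lift₀ σ ⟨$⟩ʳ_
  row′ : Fin (suc n) → ℕ
  row′ i = sum (map (λ j → inverted σ′ (i , j)) (allFin (suc n)))
  row′-zero : row′ zero ≡ 0
  row′-zero = trans (sum-allFin-suc (λ j → inverted σ′ (zero , j)))
                    (sum-zeros (λ j → inverted σ′ (zero , suc j)) (λ _ → refl) (allFin n))
  row′-suc : ∀ i → row′ (suc i) ≡ sum (map (λ j → inverted (σ ⟨$⟩ʳ_) (i , j)) (allFin n))
  row′-suc i = sum-allFin-suc (λ j → inverted σ′ (suc i , j))

sgn-lift₀ : (σ : Permutation′ n) → sgn (lift₀ σ) ≡ sgn σ
sgn-lift₀ σ = cong signℕ (begin
  inversions (lift₀ σ)            ≡⟨ inversions≡invertedPairs (lift₀ σ) ⟩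
  invertedPairs (lift₀ σ ⟨$⟩ʳ_)   ≡⟨ invertedPairs-lift₀ σ ⟩
  invertedPairs (σ ⟨$⟩ʳ_)         ≡⟨ inversions≡invertedPairs σ ⟨
  inversions σ                    ∎)
  where open ≡-Reasoning

sgn-Fin1 : (σ : Permutation′ 1) → sgn σ ≡ 1ℚ
sgn-Fin1 σ with σ ⟨$⟩ʳ zero
... | zero = refl

-- Bases

memb≡false⇒∉ : {y : Fin n} {S : Subset n} → memb y S ≡ false → y ∉ S
memb≡false⇒∉ {y = y} {S} _ with y ∈? S
memb≡false⇒∉ () | yes _
memb≡false⇒∉ _  | no y∉S = y∉S

∣⁅x⁆∪p∣≡1+∣p∣ : (x : Fin n) (p : Subset n) → x ∉ p → ∣ ⁅ x ⁆ ∪ p ∣ ≡ suc ∣ p ∣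
∣⁅x⁆∪p∣≡1+∣p∣ zero    (false ∷ p) _   = cong (suc ∘ ∣_∣) (∪-identityˡ p)
∣⁅x⁆∪p∣≡1+∣p∣ zero    (true ∷ p)  x∉p = contradiction here x∉p
∣⁅x⁆∪p∣≡1+∣p∣ (suc x) (true ∷ p)  x∉p = cong suc (∣⁅x⁆∪p∣≡1+∣p∣ x p (x∉p ∘ there))
∣⁅x⁆∪p∣≡1+∣p∣ (suc x) (false ∷ p) x∉p = ∣⁅x⁆∪p∣≡1+∣p∣ x p (x∉p ∘ there)

n≤∣p∣⇒x∈p : {x : Fin n} {p : Subset n} → n ≤ ∣ p ∣ → x ∈ p
n≤∣p∣⇒x∈p {n} {x} {p} n≤∣p∣ =
  subst (x ∈_) (sym (∣p∣≡n⇒p≡⊤ (ℕ.≤-antisym (∣p∣≤n p) n≤∣p∣))) ∈⊤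

blocked : RawSys n → Subset n → Fin n → Bool
blocked R S y = memb y S ∨ not (R (⁅ y ⁆ ∪ S))

-- isBasis, isColoop and isLoop restated for raw systems, so that they can be transported along ≗.
isBasisSys : RawSys n → Subset n → Bool
isBasisSys {n} R B = R B ∧ allB (blocked R B) (allFin n)

isColoopSys : RawSys n → Fin n → Bool
isColoopSys {n} R x = allB (λ B → not (isBasisSys R B) ∨ memb x B) (allSubsets n)

isLoopSys : RawSys n → Fin n → Bool
isLoopSys R x = not (R ⁅ x ⁆)

unblocked⇒extends : (R : RawSys n) (S : Subset n) (y : Fin n) → blocked R S y ≡ false →
                    y ∉ S × R (⁅ y ⁆ ∪ S) ≡ true
unblocked⇒extends R S y free =
  memb≡false⇒∉ (∨-conicalˡ (memb y S) _ free) , not-injective (∨-conicalʳ (memb y S) _ free)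

-- The fuel suffices: at most n elements can be added before S is the whole ground set.
extend-to-basis : (M : Matroid n) (fuel : ℕ) (S : Subset n) → indep M S ≡ true → n ≤ fuel ℕ.+ ∣ S ∣ →
                  ∃ λ B → isBasisSys (indep M) B ≡ true
extend-to-basis {n} M fuel S S-indep bound with allB-counterexample (blocked (indep M) S) (allFin n)
... | inj₁ S-maximal = S , cong₂ _∧_ S-indep S-maximal
extend-to-basis M zero S S-indep bound | inj₂ (y , y-free) =
  contradiction (n≤∣p∣⇒x∈p bound) (proj₁ (unblocked⇒extends (indep M) S y y-free))
extend-to-basis {n} M (suc fuel) S S-indep bound | inj₂ (y , y-free) =
  extend-to-basis M fuel (⁅ y ⁆ ∪ S) S∪y-indep (subst (n ≤_) size bound)
  where
  y∉S = proj₁ (unblocked⇒extends (indep M) S y y-free)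
  S∪y-indep = proj₂ (unblocked⇒extends (indep M) S y y-free)
  size : suc fuel ℕ.+ ∣ S ∣ ≡ fuel ℕ.+ ∣ ⁅ y ⁆ ∪ S ∣
  size = trans (sym (ℕ.+-suc fuel ∣ S ∣)) (cong (fuel ℕ.+_) (sym (∣⁅x⁆∪p∣≡1+∣p∣ y S y∉S)))

basis : (M : Matroid n) → ∃ λ B → isBasisSys (indep M) B ≡ true
basis {n} M = extend-to-basis M n ⊥ (I1 M) (ℕ.m≤m+n n ∣ ⊥ {n} ∣)

-- Boundaries and cones

removable : Kind → RawSys (suc k) → Fin (suc k) → Bool
removable deletion    R i = not (isColoopSys R i)
removable contraction R i = not (isLoopSys R i)

minor : Kind → RawSys (suc k) → Fin (suc k) → RawSys k
minor deletion    = delSys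
minor contraction = conSys

boundaryTerm : Kind → ℚ → RawSys (suc k) → RawSys k → ℚ
boundaryTerm {k} κ q R N =
  sumℚ (map (λ i → q * signℕ (toℕ i) * ind (removable κ R i ∧ eqSys (minor κ R i) N)) (allFin (suc k)))

boundary-[] : ∀ κ (N : RawSys k) → boundary κ [] N ≡ 0ℚ
boundary-[] deletion    N = refl
boundary-[] contraction N = refl

boundary-∷ : ∀ κ q (M : Matroid (suc k)) x N →
  boundary κ ((q , M) ∷ x) N ≡ boundaryTerm κ q (indep M) N + boundary κ x N
boundary-∷ deletion    q M x N = refl
boundary-∷ contraction q M x N = refl

-- The new element 0 is a loop for deletion and a coloop for contraction.
coneSys : Kind → RawSys n → RawSys (suc n)
coneSys deletion    R (b ∷ S) = not b ∧ R S
coneSys contraction R (b ∷ S) = R S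

⊆-tail : ∀ {b c} {S T : Subset n} → (b ∷ S) ⊆ (c ∷ T) → S ⊆ T
⊆-tail b∷S⊆c∷T x∈S with b∷S⊆c∷T (there x∈S)
... | there x∈T = x∈T

Exchange : RawSys n → Subset n → Subset n → Set
Exchange R S T = ∃ λ x → x ∈ T × x ∉ S × R (⁅ x ⁆ ∪ S) ≡ true

exchange-∷ : {R : RawSys n} (P : RawSys (suc n)) {b c : Bool} {S T : Subset n} →
             (∀ S′ → R S′ ≡ true → P (b ∷ S′) ≡ true) → Exchange R S T → Exchange P (b ∷ S) (c ∷ T)
exchange-∷ P lift (x , x∈T , x∉S , indep) =
  suc x , there x∈T , (λ { (there x∈S) → x∉S x∈S }) , lift _ indep

module _ (M : Matroid n) where

  cone-I1 : ∀ κ → coneSys κ (indep M) ⊥ ≡ true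
  cone-I1 deletion    = I1 M
  cone-I1 contraction = I1 M

  cone-I2 : ∀ κ {S T} → S ⊆ T → coneSys κ (indep M) T ≡ true → coneSys κ (indep M) S ≡ true
  cone-I2 deletion    {b ∷ S}     {true ∷ T}  S⊆T ()
  cone-I2 deletion    {true ∷ S}  {false ∷ T} S⊆T T-indep with S⊆T here
  ... | ()
  cone-I2 deletion    {false ∷ S} {false ∷ T} S⊆T T-indep = I2 M (⊆-tail S⊆T) T-indep
  cone-I2 contraction {b ∷ S}     {c ∷ T}     S⊆T T-indep = I2 M (⊆-tail S⊆T) T-indep

  cone-I3 : ∀ κ {S T} → coneSys κ (indep M) S ≡ true → coneSys κ (indep M) T ≡ true →
            ∣ S ∣ ℕ.< ∣ T ∣ → Exchange (coneSys κ (indep M)) S T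
  cone-I3 deletion {true ∷ S}  {T}         ()
  cone-I3 deletion {false ∷ S} {true ∷ T}  S-indep ()
  cone-I3 deletion {false ∷ S} {false ∷ T} S-indep T-indep S<T =
    exchange-∷ (coneSys deletion (indep M)) (λ _ → id) (I3 M S-indep T-indep S<T)
  cone-I3 contraction {false ∷ S} {true ∷ T} S-indep T-indep S<T =
    zero , here , (λ ()) , subst (λ S′ → indep M S′ ≡ true) (sym (∪-identityˡ S)) S-indep
  cone-I3 contraction {true ∷ S} {true ∷ T} S-indep T-indep (ℕ.s≤s S<T) =
    exchange-∷ (coneSys contraction (indep M)) (λ _ → id) (I3 M S-indep T-indep S<T)
  cone-I3 contraction {false ∷ S} {false ∷ T} S-indep T-indep S<T =
    exchange-∷ (coneSys contraction (indep M)) (λ _ → id) (I3 M S-indep T-indep S<T)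
  cone-I3 contraction {true ∷ S} {false ∷ T} S-indep T-indep S<T =
    exchange-∷ (coneSys contraction (indep M)) (λ _ → id) (I3 M S-indep T-indep (ℕ.<⇒≤ S<T))

cone : Kind → Matroid n → Matroid (suc n)
cone κ M = record { indep = coneSys κ (indep M) ; I1 = cone-I1 M κ ; I2 = cone-I2 M κ ; I3 = cone-I3 M κ }

minor-cone-zero : ∀ κ (R : RawSys n) → minor κ (coneSys κ R) zero ≗ R
minor-cone-zero deletion    R S = refl
minor-cone-zero contraction R S = refl

minor-cone-suc : ∀ κ (R : RawSys (suc k)) j → minor κ (coneSys κ R) (suc j) ≗ coneSys κ (minor κ R j)
minor-cone-suc deletion    R j (b ∷ S) = refl
minor-cone-suc contraction R j (b ∷ S) = refl

isCone : Kind → RawSys (suc n) → Bool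
isCone deletion    N = eqSys (λ _ → false) (conSys N zero)
isCone contraction N = eqSys (conSys N zero) (delSys N zero)

eqSys-coneSys : ∀ κ (R : RawSys n) N → eqSys (coneSys κ R) N ≡ isCone κ N ∧ eqSys R (minor κ N zero)
eqSys-coneSys deletion R N = eqSys-suc (coneSys deletion R) N
eqSys-coneSys {n} contraction R N = begin
  eqSys (coneSys contraction R) N
    ≡⟨ eqSys-suc (coneSys contraction R) N ⟩
  eqSys R (conSys N zero) ∧ eqSys R (delSys N zero)
    ≡⟨ allB-∧ (λ S → R S ==ᵇ conSys N zero S) (λ S → R S ==ᵇ delSys N zero S) (allSubsets n) ⟨
  allB (λ S → (R S ==ᵇ conSys N zero S) ∧ (R S ==ᵇ delSys N zero S)) (allSubsets n)
    ≡⟨ allB-cong (λ S → ==ᵇ-∧-==ᵇ (R S) (conSys N zero S) (delSys N zero S)) (allSubsets n) ⟩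
  allB (λ S → (conSys N zero S ==ᵇ delSys N zero S) ∧ (R S ==ᵇ conSys N zero S)) (allSubsets n)
    ≡⟨ allB-∧ (λ S → conSys N zero S ==ᵇ delSys N zero S) (λ S → R S ==ᵇ conSys N zero S) (allSubsets n) ⟩
  isCone contraction N ∧ eqSys R (conSys N zero) ∎
  where open ≡-Reasoning

isBasisSys-coneSys : (R : RawSys n) (B : Subset n) → isBasisSys (coneSys deletion R) (false ∷ B) ≡ isBasisSys R B
isBasisSys-coneSys R B = cong (R B ∧_) (allB-allFin-suc (blocked (coneSys deletion R) (false ∷ B)))

removable-cone-zero : ∀ κ (M : Matroid n) → removable κ (coneSys κ (indep M)) zero ≡ true
removable-cone-zero deletion M with basis M
... | B , B-basis = cong not (allB-allSubsets-false _ (false ∷ B)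
        (cong (λ b → not b ∨ false) (trans (isBasisSys-coneSys (indep M) B) B-basis)))
removable-cone-zero contraction M = cong (not ∘ not) (I1 M)

removable-cone-suc : ∀ κ (R : RawSys (suc k)) j → removable κ (coneSys κ R) (suc j) ≡ removable κ R j
removable-cone-suc {k} deletion R j = cong not (begin
  isColoopSys (coneSys deletion R) (suc j)
    ≡⟨ allB-allSubsets-suc (λ B → not (isBasisSys (coneSys deletion R) B) ∨ memb (suc j) B) ⟩
  allB (λ B → true) (allSubsets (suc k)) ∧
  allB (λ B → not (isBasisSys (coneSys deletion R) (false ∷ B)) ∨ memb j B) (allSubsets (suc k))
    ≡⟨ cong₂ _∧_ (allB-true (λ _ → refl) (allSubsets (suc k)))
                 (allB-cong (λ B → cong (λ b → not b ∨ memb j B) (isBasisSys-coneSys R B)) (allSubsets (suc k))) ⟩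
  isColoopSys R j ∎)
  where open ≡-Reasoning
removable-cone-suc contraction R j = refl

coneCoeff : Kind → (RawSys n → ℚ) → RawSys (suc n) → ℚ
coneCoeff κ f N = ind (isCone κ N) * f (minor κ N zero)

coneCoeff-cong : ∀ κ {f g : RawSys n → ℚ} → f ≗ g → coneCoeff κ f ≗ coneCoeff κ g
coneCoeff-cong κ f≗g N = cong (ind (isCone κ N) *_) (f≗g _)

ind-eqSys-coneSys : ∀ κ (R : RawSys n) N → ind (eqSys (coneSys κ R) N) ≡ coneCoeff κ (ind ∘ eqSys R) N
ind-eqSys-coneSys κ R N = trans (cong ind (eqSys-coneSys κ R N)) (ind-∧ (isCone κ N) (eqSys R (minor κ N zero)))

-- The apex is removable and contributes M itself; every other term is the cone of a term of ∂M,
-- with opposite sign.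
boundaryTerm-cone : ∀ κ q (M : Matroid (suc k)) N →
  boundaryTerm κ q (coneSys κ (indep M)) N ≡ q * ind (eqSys (indep M) N) - coneCoeff κ (boundaryTerm κ q (indep M)) N
boundaryTerm-cone {k} κ q M N = begin
  boundaryTerm κ q R′ N
    ≡⟨ sumℚ-allFin-suc F ⟩
  F zero + sumℚ (map (F ∘ suc) (allFin (suc k)))
    ≡⟨ cong₂ _+_ apex-term (cong sumℚ (map-cong other-term (allFin (suc k)))) ⟩
  q * ind (eqSys R N) + sumℚ (map (λ j → - c * H j) (allFin (suc k)))
    ≡⟨ cong (q * ind (eqSys R N) +_)
            (trans (sumℚ-map-*ˡ (- c) H (allFin (suc k))) (sym (ℚ.neg-distribˡ-* c _))) ⟩
  q * ind (eqSys R N) - c * boundaryTerm κ q R (minor κ N zero) ∎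
  where
  open ≡-Reasoning
  R = indep M
  R′ = coneSys κ R
  c = ind (isCone κ N)
  F : Fin (suc (suc k)) → ℚ
  F i = q * signℕ (toℕ i) * ind (removable κ R′ i ∧ eqSys (minor κ R′ i) N)
  H : Fin (suc k) → ℚ
  H j = q * signℕ (toℕ j) * ind (removable κ R j ∧ eqSys (minor κ R j) (minor κ N zero))
  apex-term : F zero ≡ q * ind (eqSys R N)
  apex-term = begin
    q * 1ℚ * ind (removable κ R′ zero ∧ eqSys (minor κ R′ zero) N)
      ≡⟨ cong₂ (λ r e → q * 1ℚ * ind (r ∧ e))
               (removable-cone-zero κ M) (eqSys-congˡ (minor-cone-zero κ R) N) ⟩
    q * 1ℚ * ind (eqSys R N)
      ≡⟨ cong (_* ind (eqSys R N)) (ℚ.*-identityʳ q) ⟩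
    q * ind (eqSys R N) ∎
  other-term : ∀ j → F (suc j) ≡ - c * H j
  other-term j = begin
    q * - s * ind (removable κ R′ (suc j) ∧ eqSys (minor κ R′ (suc j)) N)
      ≡⟨ cong₂ (λ r e → q * - s * ind (r ∧ e)) (removable-cone-suc κ R j)
               (trans (eqSys-congˡ (minor-cone-suc κ R j) N) (eqSys-coneSys κ (minor κ R j) N)) ⟩
    q * - s * ind (removable κ R j ∧ (isCone κ N ∧ e))
      ≡⟨ cong (λ b → q * - s * ind b) (∧-leftComm (removable κ R j) (isCone κ N) e) ⟩
    q * - s * ind (isCone κ N ∧ (removable κ R j ∧ e))
      ≡⟨ cong (q * - s *_) (ind-∧ (isCone κ N) _) ⟩
    q * - s * (c * ind (removable κ R j ∧ e))
      ≡⟨ solve 4 (λ q s c t → q :* (:- s) :* (c :* t) := (:- c) :* (q :* s :* t)) refl q s c _ ⟩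
    - c * H j ∎
    where
    s = signℕ (toℕ j)
    e = eqSys (minor κ R j) (minor κ N zero)

coneChain : Kind → Chain n → Chain (suc n)
coneChain κ = map (map₂ (cone κ))

boundary-coneChain : ∀ κ (x : Chain (suc k)) N →
  boundary κ (coneChain κ x) N ≡ coeff x N - coneCoeff κ (boundary κ x) N
boundary-coneChain κ [] N = begin
  boundary κ [] N                    ≡⟨ boundary-[] κ N ⟩
  0ℚ                                 ≡⟨ solve 1 (λ c → con 0ℚ := con 0ℚ :- c :* con 0ℚ) refl (ind (isCone κ N)) ⟩
  0ℚ - ind (isCone κ N) * 0ℚ         ≡⟨ cong (λ b → 0ℚ - ind (isCone κ N) * b) (boundary-[] κ _) ⟨
  0ℚ - coneCoeff κ (boundary κ []) N ∎
  where open ≡-Reasoning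
boundary-coneChain κ ((q , M) ∷ x) N = begin
  boundary κ ((q , cone κ M) ∷ coneChain κ x) N
    ≡⟨ boundary-∷ κ q (cone κ M) (coneChain κ x) N ⟩
  boundaryTerm κ q (coneSys κ (indep M)) N + boundary κ (coneChain κ x) N
    ≡⟨ cong₂ _+_ (boundaryTerm-cone κ q M N) (boundary-coneChain κ x N) ⟩
  (q * ind (eqSys (indep M) N) - c * t) + (coeff x N - c * b)
    ≡⟨ solve 5 (λ a t x c b → (a :- c :* t) :+ (x :- c :* b) := (a :+ x) :- c :* (t :+ b)) refl
               (q * ind (eqSys (indep M) N)) t (coeff x N) c b ⟩
  coeff ((q , M) ∷ x) N - c * (t + b)
    ≡⟨ cong (λ z → coeff ((q , M) ∷ x) N - c * z) (boundary-∷ κ q M x (minor κ N zero)) ⟨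
  coeff ((q , M) ∷ x) N - coneCoeff κ (boundary κ ((q , M) ∷ x)) N ∎
  where
  open ≡-Reasoning
  c = ind (isCone κ N)
  t = boundaryTerm κ q (indep M) (minor κ N zero)
  b = boundary κ x (minor κ N zero)

coneGen : Kind → Gen n → Gen (suc n)
coneGen κ g = record
  { src = cone κ (Gen.src g) ; tgt = cone κ (Gen.tgt g) ; perm = lift₀ (Gen.perm g) ; iso = iso κ }
  where
  iso : ∀ κ S → coneSys κ (indep (Gen.tgt g)) (image (lift₀ (Gen.perm g)) S) ≡ coneSys κ (indep (Gen.src g)) S
  iso deletion    (b ∷ S) = cong (not b ∧_) (Gen.iso g S)
  iso contraction (b ∷ S) = Gen.iso g S

genCoeff-coneGen : ∀ κ (g : Gen n) N → genCoeff (coneGen κ g) N ≡ coneCoeff κ (genCoeff g) N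
genCoeff-coneGen κ g N = begin
  ind (eqSys (coneSys κ (indep src)) N) - sgn (lift₀ σ) * ind (eqSys (coneSys κ (indep tgt)) N)
    ≡⟨ cong₂ (λ a b → a - b) (ind-eqSys-coneSys κ (indep src) N)
             (cong₂ _*_ (sgn-lift₀ σ) (ind-eqSys-coneSys κ (indep tgt) N)) ⟩
  c * a - sgn σ * (c * b)
    ≡⟨ solve 4 (λ c a s b → c :* a :- s :* (c :* b) := c :* (a :- s :* b)) refl c a (sgn σ) b ⟩
  coneCoeff κ (genCoeff g) N ∎
  where
  open ≡-Reasoning
  open Gen g renaming (perm to σ)
  c = ind (isCone κ N)
  a = ind (eqSys (indep src) (minor κ N zero))
  b = ind (eqSys (indep tgt) (minor κ N zero))

relSum : List (ℚ × Gen n) → RawSys n → ℚ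
relSum gs N = sumℚ (map (λ cg → proj₁ cg * genCoeff (proj₂ cg) N) gs)

coneRelations : Kind → List (ℚ × Gen n) → List (ℚ × Gen (suc n))
coneRelations κ = map (λ (q , g) → - q , coneGen κ g)

relSum-coneRelations : ∀ κ (gs : List (ℚ × Gen n)) N →
  relSum (coneRelations κ gs) N ≡ - coneCoeff κ (relSum gs) N
relSum-coneRelations κ [] N = sym (cong -_ (ℚ.*-zeroʳ (ind (isCone κ N))))
relSum-coneRelations κ ((q , g) ∷ gs) N = begin
  - q * genCoeff (coneGen κ g) N + relSum (coneRelations κ gs) N
    ≡⟨ cong₂ (λ a b → - q * a + b) (genCoeff-coneGen κ g N) (relSum-coneRelations κ gs N) ⟩
  - q * (c * genCoeff g (minor κ N zero)) + - (c * relSum gs (minor κ N zero))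
    ≡⟨ solve 4 (λ q c a r → (:- q) :* (c :* a) :+ (:- (c :* r)) := :- (c :* (q :* a :+ r))) refl
               q c (genCoeff g (minor κ N zero)) (relSum gs (minor κ N zero)) ⟩
  - coneCoeff κ (relSum ((q , g) ∷ gs)) N ∎
  where
  open ≡-Reasoning
  c = ind (isCone κ N)

cycle⇒boundary : ∀ κ (x : Chain (suc k)) → Rel (boundary κ x) zeroF →
                 ∃ λ (y : Chain (suc (suc k))) → Rel (boundary κ y) (coeff x)
cycle⇒boundary κ x (gs , ∂x≡relSum) = coneChain κ x , coneRelations κ gs , λ N → begin
  boundary κ (coneChain κ x) N - coeff x N
    ≡⟨ cong (_- coeff x N) (boundary-coneChain κ x N) ⟩
  coeff x N - coneCoeff κ (boundary κ x) N - coeff x N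
    ≡⟨ solve 2 (λ a b → a :- b :- a := :- b) refl (coeff x N) _ ⟩
  - coneCoeff κ (boundary κ x) N
    ≡⟨ cong -_ (coneCoeff-cong κ ∂x≗relSum N) ⟩
  - coneCoeff κ (relSum gs) N
    ≡⟨ relSum-coneRelations κ gs N ⟨
  relSum (coneRelations κ gs) N ∎
  where
  open ≡-Reasoning
  ∂x≗relSum : boundary κ x ≗ relSum gs
  ∂x≗relSum N′ = trans (sym (ℚ.+-identityʳ (boundary κ x N′))) (∂x≡relSum N′)

-- Degree one

emptyMatroid : Matroid 0
emptyMatroid = record { indep = λ _ → true ; I1 = refl ; I2 = λ _ _ → refl ; I3 = λ { {[]} {[]} _ _ () } }

apex : Kind → Matroid 1
apex κ = cone κ emptyMatroid

dual : Kind → Kind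
dual deletion    = contraction
dual contraction = deletion

apexChain : Kind → Chain 1
apexChain κ = (1ℚ , apex κ) ∷ []

image-Fin1 : (σ : Permutation′ 1) → image σ ≗ id
image-Fin1 σ (b ∷ []) with σ ⟨$⟩ˡ zero
... | zero = refl

genCoeff-Fin1 : (g : Gen 1) (N : RawSys 1) → genCoeff g N ≡ 0ℚ
genCoeff-Fin1 g N = begin
  ind (eqSys (indep src) N) - sgn σ * ind (eqSys (indep tgt) N)
    ≡⟨ cong₂ (λ s b → ind (eqSys (indep src) N) - s * ind b) (sgn-Fin1 σ) (eqSys-congˡ tgt≗src N) ⟩
  ind (eqSys (indep src) N) - 1ℚ * ind (eqSys (indep src) N)
    ≡⟨ solve 1 (λ a → a :- con 1ℚ :* a := con 0ℚ) refl (ind (eqSys (indep src) N)) ⟩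
  0ℚ ∎
  where
  open ≡-Reasoning
  open Gen g renaming (perm to σ)
  tgt≗src : indep tgt ≗ indep src
  tgt≗src S = trans (cong (indep tgt) (sym (image-Fin1 σ S))) (iso S)

relSum-Fin1 : (gs : List (ℚ × Gen 1)) (N : RawSys 1) → relSum gs N ≡ 0ℚ
relSum-Fin1 [] N = refl
relSum-Fin1 ((q , g) ∷ gs) N = begin
  q * genCoeff g N + relSum gs N ≡⟨ cong₂ (λ a b → q * a + b) (genCoeff-Fin1 g N) (relSum-Fin1 gs N) ⟩
  q * 0ℚ + 0ℚ                    ≡⟨ solve 1 (λ q → q :* con 0ℚ :+ con 0ℚ := con 0ℚ) refl q ⟩
  0ℚ                             ∎
  where open ≡-Reasoning

reachesApex : Kind → RawSys 2 → Fin 2 → Bool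
reachesApex κ R i = removable κ R i ∧ eqSys (minor κ R i) (indep (apex κ))

removable-cong : ∀ κ {R R′ : RawSys (suc k)} → R ≗ R′ → ∀ i → removable κ R i ≡ removable κ R′ i
removable-cong {k} deletion {R} {R′} R≗R′ i =
  cong not (allB-cong (λ B → cong (λ b → not b ∨ memb i B) (isBasis-cong B)) (allSubsets (suc k)))
  where
  isBasis-cong : ∀ B → isBasisSys R B ≡ isBasisSys R′ B
  isBasis-cong B =
    cong₂ _∧_ (R≗R′ B) (allB-cong (λ y → cong (λ b → memb y B ∨ not b) (R≗R′ _)) (allFin (suc k)))
removable-cong contraction R≗R′ i = cong not (cong not (R≗R′ _))

minor-cong : ∀ κ {R R′ : RawSys (suc k)} → R ≗ R′ → ∀ i → minor κ R i ≗ minor κ R′ i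
minor-cong deletion    R≗R′ i S = R≗R′ _
minor-cong contraction R≗R′ i S = R≗R′ _

reachesApex-cong : ∀ κ {R R′ : RawSys 2} → R ≗ R′ → ∀ i → reachesApex κ R i ≡ reachesApex κ R′ i
reachesApex-cong κ R≗R′ i =
  cong₂ _∧_ (removable-cong κ R≗R′ i) (eqSys-congˡ (minor-cong κ R≗R′ i) (indep (apex κ)))

table₂ : Bool → Bool → Bool → RawSys 2
table₂ b c d (false ∷ false ∷ []) = true
table₂ b c d (true  ∷ false ∷ []) = b
table₂ b c d (false ∷ true  ∷ []) = c
table₂ b c d (true  ∷ true  ∷ []) = d

reachesApex-table₂ : ∀ κ b c d → (d ≡ true → b ≡ true) → (d ≡ true → c ≡ true) →
                     reachesApex κ (table₂ b c d) zero ≡ reachesApex κ (table₂ b c d) (suc zero)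
reachesApex-table₂ deletion    false false false _ _ = refl
reachesApex-table₂ deletion    false true  false _ _ = refl
reachesApex-table₂ deletion    true  false false _ _ = refl
reachesApex-table₂ deletion    true  true  false _ _ = refl
reachesApex-table₂ contraction false false false _ _ = refl
reachesApex-table₂ contraction false true  false _ _ = refl
reachesApex-table₂ contraction true  false false _ _ = refl
reachesApex-table₂ contraction true  true  false _ _ = refl
reachesApex-table₂ κ b c true d⇒b d⇒c with d⇒b refl | d⇒c refl
reachesApex-table₂ deletion    true true true _ _ | refl | refl = refl
reachesApex-table₂ contraction true true true _ _ | refl | refl = refl

matroid₂-table₂ : (M : Matroid 2) →
  indep M ≗ table₂ (indep M (true ∷ false ∷ [])) (indep M (false ∷ true ∷ [])) (indep M (true ∷ true ∷ []))
matroid₂-table₂ M (false ∷ false ∷ []) = I1 M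
matroid₂-table₂ M (true  ∷ false ∷ []) = refl
matroid₂-table₂ M (false ∷ true  ∷ []) = refl
matroid₂-table₂ M (true  ∷ true  ∷ []) = refl

reachesApex-symmetric : ∀ κ (M : Matroid 2) → reachesApex κ (indep M) zero ≡ reachesApex κ (indep M) (suc zero)
reachesApex-symmetric κ M = begin
  reachesApex κ (indep M) zero        ≡⟨ reachesApex-cong κ (matroid₂-table₂ M) zero ⟩
  reachesApex κ (table₂ b c d) zero
    ≡⟨ reachesApex-table₂ κ b c d (I2 M (λ _ → ∈⊤)) (I2 M (λ _ → ∈⊤)) ⟩
  reachesApex κ (table₂ b c d) (suc zero) ≡⟨ reachesApex-cong κ (matroid₂-table₂ M) (suc zero) ⟨
  reachesApex κ (indep M) (suc zero)  ∎
  where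
  open ≡-Reasoning
  b = indep M (true ∷ false ∷ [])
  c = indep M (false ∷ true ∷ [])
  d = indep M (true ∷ true ∷ [])

matroid₁-cases : (M : Matroid 1) → indep M ≗ indep (apex deletion) ⊎ indep M ≗ indep (apex contraction)
matroid₁-cases M with indep M (true ∷ []) in M-point
... | false = inj₁ λ { (false ∷ []) → I1 M ; (true ∷ []) → M-point }
... | true  = inj₂ λ { (false ∷ []) → I1 M ; (true ∷ []) → M-point }

apex-or-dual : ∀ κ (M : Matroid 1) → indep M ≗ indep (apex κ) ⊎ indep M ≗ indep (apex (dual κ))
apex-or-dual deletion    M = matroid₁-cases M
apex-or-dual contraction M = swap (matroid₁-cases M)

apex≢dual : ∀ κ → eqSys (indep (apex κ)) (indep (apex (dual κ))) ≡ false
apex≢dual deletion    = refl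
apex≢dual contraction = refl

dual≢apex : ∀ κ → eqSys (indep (apex (dual κ))) (indep (apex κ)) ≡ false
dual≢apex deletion    = refl
dual≢apex contraction = refl

dualApex-not-removable : ∀ κ → removable κ (indep (apex (dual κ))) zero ≡ false
dualApex-not-removable deletion    = refl
dualApex-not-removable contraction = refl

module _ (κ : Kind) where

  private
    P Q : RawSys 1
    P = indep (apex κ)
    Q = indep (apex (dual κ))

  boundaryTerm-at-apex : ∀ q (M : Matroid 2) → boundaryTerm κ q (indep M) P ≡ 0ℚ
  boundaryTerm-at-apex q M = begin
    q * 1ℚ * ind (reachesApex κ (indep M) zero) + (q * - 1ℚ * ind (reachesApex κ (indep M) (suc zero)) + 0ℚ)
      ≡⟨ cong (λ r → q * 1ℚ * a + (q * - 1ℚ * ind r + 0ℚ)) (reachesApex-symmetric κ M) ⟨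
    q * 1ℚ * a + (q * - 1ℚ * a + 0ℚ)
      ≡⟨ solve 2 (λ q a → q :* con 1ℚ :* a :+ (q :* (:- con 1ℚ) :* a :+ con 0ℚ) := con 0ℚ) refl q a ⟩
    0ℚ ∎
    where
    open ≡-Reasoning
    a = ind (reachesApex κ (indep M) zero)

  boundary-at-apex : (y : Chain 2) → boundary κ y P ≡ 0ℚ
  boundary-at-apex [] = boundary-[] κ P
  boundary-at-apex ((q , M) ∷ y) = begin
    boundary κ ((q , M) ∷ y) P        ≡⟨ boundary-∷ κ q M y P ⟩
    boundaryTerm κ q (indep M) P + boundary κ y P
                                      ≡⟨ cong₂ _+_ (boundaryTerm-at-apex q M) (boundary-at-apex y) ⟩
    0ℚ + 0ℚ                           ≡⟨ ℚ.+-identityʳ 0ℚ ⟩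
    0ℚ                                ∎
    where open ≡-Reasoning

  apexChain-not-boundary : ¬ (∃ λ (y : Chain 2) → Rel (boundary κ y) (coeff (apexChain κ)))
  apexChain-not-boundary (y , gs , ∂y≡relSum) = -1≢0 (begin
    0ℚ - 1ℚ                                ≡⟨ cong₂ _-_ (boundary-at-apex y) coeff-apexChain ⟨
    boundary κ y P - coeff (apexChain κ) P ≡⟨ ∂y≡relSum P ⟩
    relSum gs P                            ≡⟨ relSum-Fin1 gs P ⟩
    0ℚ                                     ∎)
    where
    open ≡-Reasoning
    -1≢0 : 0ℚ - 1ℚ ≢ 0ℚ
    -1≢0 ()
    coeff-apexChain : coeff (apexChain κ) P ≡ 1ℚ
    coeff-apexChain = cong (λ b → 1ℚ * ind b + 0ℚ) (eqSys-refl P)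

  ind-eqSys-Fin1 : (M : Matroid 1) (N : RawSys 1) →
    ind (eqSys (indep M) N) ≡ ind (eqSys (indep M) P) * ind (eqSys P N) + ind (eqSys (indep M) Q) * ind (eqSys Q N)
  ind-eqSys-Fin1 M N with apex-or-dual κ M
  ... | inj₁ M≗P = ind-eqSys-decompose Q M≗P (apex≢dual κ) N
  ... | inj₂ M≗Q = trans (ind-eqSys-decompose P M≗Q (dual≢apex κ) N)
                         (ℚ.+-comm (ind (eqSys (indep M) Q) * ind (eqSys Q N))
                                   (ind (eqSys (indep M) P) * ind (eqSys P N)))

  coeff-Fin1 : (x : Chain 1) (N : RawSys 1) → coeff x N ≡ coeff x P * ind (eqSys P N) + coeff x Q * ind (eqSys Q N)
  coeff-Fin1 [] N = solve 2 (λ a b → con 0ℚ := con 0ℚ :* a :+ con 0ℚ :* b) refl (ind (eqSys P N)) (ind (eqSys Q N))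
  coeff-Fin1 ((q , M) ∷ x) N = begin
    q * ind (eqSys (indep M) N) + coeff x N
      ≡⟨ cong₂ (λ u v → q * u + v) (ind-eqSys-Fin1 M N) (coeff-Fin1 x N) ⟩
    q * (mP * a + mQ * b) + (xP * a + xQ * b)
      ≡⟨ solve 7 (λ q mP mQ xP xQ a b → q :* (mP :* a :+ mQ :* b) :+ (xP :* a :+ xQ :* b)
                                       := (q :* mP :+ xP) :* a :+ (q :* mQ :+ xQ) :* b) refl q mP mQ xP xQ a b ⟩
    (q * mP + xP) * a + (q * mQ + xQ) * b ∎
    where
    open ≡-Reasoning
    a = ind (eqSys P N)
    b = ind (eqSys Q N)
    mP = ind (eqSys (indep M) P)
    mQ = ind (eqSys (indep M) Q)
    xP = coeff x P
    xQ = coeff x Q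

  dualApex-cycle : (d : ℚ) (N : RawSys 0) → boundary κ ((d , apex (dual κ)) ∷ []) N ≡ 0ℚ
  dualApex-cycle d N = begin
    boundary κ ((d , apex (dual κ)) ∷ []) N
      ≡⟨ boundary-∷ κ d (apex (dual κ)) [] N ⟩
    d * 1ℚ * ind (removable κ Q zero ∧ eqSys (minor κ Q zero) N) + 0ℚ + boundary κ [] N
      ≡⟨ cong₂ (λ r z → d * 1ℚ * ind (r ∧ eqSys (minor κ Q zero) N) + 0ℚ + z)
               (dualApex-not-removable κ) (boundary-[] κ N) ⟩
    d * 1ℚ * 0ℚ + 0ℚ + 0ℚ
      ≡⟨ solve 1 (λ d → d :* con 1ℚ :* con 0ℚ :+ con 0ℚ :+ con 0ℚ := con 0ℚ) refl d ⟩
    0ℚ ∎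
    where open ≡-Reasoning

  boundary-cone-dualApex : (d : ℚ) (N : RawSys 1) →
    boundary κ (coneChain κ ((d , apex (dual κ)) ∷ [])) N ≡ d * ind (eqSys Q N)
  boundary-cone-dualApex d N = begin
    boundary κ (coneChain κ z) N
      ≡⟨ boundary-coneChain κ z N ⟩
    coeff z N - coneCoeff κ (boundary κ z) N
      ≡⟨ cong (λ w → coeff z N - w) (coneCoeff-cong κ (dualApex-cycle d) N) ⟩
    d * ind (eqSys Q N) + 0ℚ - ind (isCone κ N) * 0ℚ
      ≡⟨ solve 2 (λ x c → x :+ con 0ℚ :- c :* con 0ℚ := x) refl (d * ind (eqSys Q N)) (ind (isCone κ N)) ⟩
    d * ind (eqSys Q N) ∎
    where
    open ≡-Reasoning
    z = (d , apex (dual κ)) ∷ []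

  homologous-to-apexChain : (x : Chain 1) → ∃ λ (c : ℚ) → ∃ λ (y : Chain 2) →
    Rel (boundary κ y) (λ N → coeff x N - c * coeff (apexChain κ) N)
  homologous-to-apexChain x = coeff x P , coneChain κ z , [] , residual-vanishes
    where
    z = (coeff x Q , apex (dual κ)) ∷ []
    residual-vanishes : ∀ N →
      boundary κ (coneChain κ z) N - (coeff x N - coeff x P * coeff (apexChain κ) N) ≡ 0ℚ
    residual-vanishes N = begin
      boundary κ (coneChain κ z) N - (coeff x N - xP * coeff (apexChain κ) N)
        ≡⟨ cong₂ (λ u v → u - (v - xP * coeff (apexChain κ) N))
                 (boundary-cone-dualApex xQ N) (coeff-Fin1 x N) ⟩
      xQ * b - (xP * a + xQ * b - xP * (1ℚ * a + 0ℚ))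
        ≡⟨ solve 4 (λ xP xQ a b → xQ :* b :- (xP :* a :+ xQ :* b :- xP :* (con 1ℚ :* a :+ con 0ℚ)) := con 0ℚ)
                   refl xP xQ a b ⟩
      0ℚ ∎
      where
      open ≡-Reasoning
      a = ind (eqSys P N)
      b = ind (eqSys Q N)
      xP = coeff x P
      xQ = coeff x Q

corollary5p16 : (κ : Kind) →
    (∀ (k : ℕ) → 1 ≤ k → (x : Chain (suc k)) → Rel (boundary κ x) zeroF →
      ∃ λ (y : Chain (suc (suc k))) → Rel (boundary κ y) (coeff x))
    × (∃ λ (x₀ : Chain 1) →
        (¬ (∃ λ (y : Chain 2) → Rel (boundary κ y) (coeff x₀)))
        × (∀ (x : Chain 1) → ∃ λ (c : ℚ) → ∃ λ (y : Chain 2) →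
             Rel (boundary κ y) (λ N → coeff x N - c * coeff x₀ N)))
-- The cone argument works in every degree.
corollary5p16 κ =
  (λ _ _ → cycle⇒boundary κ) ,
  apexChain κ , apexChain-not-boundary κ , homologous-to-apexChain κ
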